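{- Let $G=(V,E)$ be a graph, fix integers $c\ge3$ and $\ell\ge1$, let ${\bf s}_G$ be the string associated to $G,c,\ell$ as in the context, and let $\varphi$ be an LZ-parsing of ${\bf s}_G$. Suppose that for some $i\in\{1,\dots,c-2\}$ and for each $j=1,\dots,\ell$, the substring $\alpha^{(i)}_j$ of $\beta^{(i)}$ contains a position $x_j$ with $hop(x_j)>i+1$ (hop-numbers with respect to $\varphi$). For $\gamma=1,\dots,\ell$, let $x_j^\gamma$ be the position in $\alpha^{(i+1)}_\gamma$ corresponding to $x_j$ (i.e. $x_j$ shifted by the offset of the start of $\alpha^{(i+1)}_\gamma$ relative to the start of ${\bf s}_G$; note $x_j$ lies in the prefix $\alpha^{(i+1)}=\alpha^{(i)}\beta^{(i)}$). If the number of phrases of $\varphi$ contained in $\beta^{(i+1)}$ is strictly less than $2\ell$, then there is $j\in\{1,\dots,\ell\}$ such that $hop(x_j^\gamma)>i+2$ for every $\gamma=1,\dots,\ell$.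
   Context: Strings: for ${\bf s}=s_1\dots s_N$, ${\bf s}[i,j]=s_i\dots s_j$. A parsing of ${\bf s}$ is a partition into consecutive nonempty substrings (phrases). An LZ-parsing is a parsing in which every phrase ${\bf s}[a,e]$ either has length $1$, or is given together with a chosen source start $b$ with $1\le b\le a-1$ and ${\bf s}[b,b+(e-a)-1]={\bf s}[a,e-1]$ (overlap allowed); each position $a+t$, $0\le t\le e-a-1$, then has source position $b+(t\bmod(a-b))$. The hop-number of position $p$ is $0$ if $p$ is the last position of a phrase and $hop(q)+1$ otherwise, where $q$ is the source position of $p$. Construction: $G$ is simple undirected with $V=\{v_1,\dots,v_n\}$, $E=\{e_1,\dots,e_m\}$; for each edge $e_i$ fix an ordering $(v_p,v_q)$ of its endpoints. Use pairwise distinct symbols $v_i,v_i',\#^v_i$ ($i\in[n]$), $e_i,\$_i,\#^e_i$ ($i\in[m]$), $\#^p_t$ ($t\in[n+m]$), $\#^{(i)}_\gamma$ ($1\le i\le c-1$, $1\le\gamma\le\ell$). $P=v_1\#^p_1\cdots v_n\#^p_n e_1\#^p_{n+1}\cdots e_m\#^p_{n+m}$; $X_i=v_i'v_i\#^v_i$, $X=X_1\cdots X_n$; for $e_i=(v_p,v_q)$, $Y_i=v_p'\,v_p\,e_i\,\$_i\,v_q'\,v_q\,e_i\,\$_i\,\#^e_i$, $Y=Y_1\cdots Y_m$; $\alpha^{(1)}=PXY$; $\beta^{(i)}=\alpha^{(i)}\#^{(i)}_1\cdots\alpha^{(i)}\#^{(i)}_\ell$, $\alpha^{(i+1)}=\alpha^{(i)}\beta^{(i)}$;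 ${\bf s}_G=\alpha^{(c)}=\alpha^{(1)}\beta^{(1)}\cdots\beta^{(c-1)}$. For $1\le i\le c-1$ and $1\le\gamma\le\ell$, $\alpha^{(i)}_\gamma$ denotes the $\gamma$-th copy of $\alpha^{(i)}$ inside $\beta^{(i)}$, i.e. the substring of length $|\alpha^{(i)}|$ immediately preceding the unique occurrence of $\#^{(i)}_\gamma$. Each $\beta^{(i)}$ starts and ends at phrase boundaries of any LZ-parsing, since its last symbol and the symbol preceding it occur only once in ${\bf s}_G$. -}

module Defs where

open import Data.Nat using (ℕ; zero; suc; _+_; _*_; _∸_; _≤_; _<_; _%_; _≤ᵇ_)
open import Data.Bool using (_∧_)
open import Data.Fin using (Fin; toℕ)
open import Data.List using (List; []; _∷_; _++_; [_]; length; take; drop; concatMap; map; upTo; allFin; filterᵇ)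
open import Data.List.Membership.Propositional using (_∈_)
open import Data.List.Relation.Unary.All using (All)
open import Data.Product using (_×_; _,_; proj₁; proj₂)
open import Data.Sum using (_⊎_)
open import Relation.Binary.PropositionalEquality using (_≡_; _≢_)

-- Simple undirected graphs with V = {v_0..v_{n-1}}, E = {e_0..e_{m-1}};
-- each edge comes with a fixed ordering (v_p , v_q) of its endpoints.

record Graph : Set where
  field
    n     : ℕ
    m     : ℕ
    edge  : Fin m → Fin n × Fin n
    noLoop : ∀ k → proj₁ (edge k) ≢ proj₂ (edge k)
    noMulti : ∀ k k' → (edge k ≡ edge k' ⊎ (proj₁ (edge k) ≡ proj₂ (edge k') × proj₂ (edge k) ≡ proj₁ (edge k')))
              → k ≡ k'

-- Pairwise distinct symbols (indices are 0-based; distinctness is all that matters)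

data Sym : Set where
  v     : ℕ → Sym
  v'    : ℕ → Sym
  hv    : ℕ → Sym          -- #^v_i
  e     : ℕ → Sym
  dol   : ℕ → Sym          -- $_i
  he    : ℕ → Sym          -- #^e_i
  hp    : ℕ → Sym          -- #^p_t
  hlev  : ℕ → ℕ → Sym      -- #^{(i)}_γ

module _ (G : Graph) where
  open Graph G

  P-str : List Sym
  P-str = concatMap (λ k → v k ∷ hp k ∷ []) (upTo n)
          ++ concatMap (λ k → e k ∷ hp (n + k) ∷ []) (upTo m)

  X-str : List Sym
  X-str = concatMap (λ k → v' k ∷ v k ∷ hv k ∷ []) (upTo n)

  Y-blk : Fin m → List Sym
  Y-blk k = let p = toℕ (proj₁ (edge k)) ; q = toℕ (proj₂ (edge k)) ; i = toℕ k in
    v' p ∷ v p ∷ e i ∷ dol i ∷ v' q ∷ v q ∷ e i ∷ dol i ∷ he i ∷ []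

  Y-str : List Sym
  Y-str = concatMap Y-blk (allFin m)

  -- alpha k = α^{(k)} for k ≥ 1 (alpha 0 is an unused dummy),
  -- beta k = β^{(k)} = α^{(k)} #^{(k)}_1 ⋯ α^{(k)} #^{(k)}_ℓ
  alpha : (ℓ : ℕ) → ℕ → List Sym
  beta  : (ℓ : ℕ) → ℕ → List Sym
  alpha ℓ zero = []
  alpha ℓ (suc zero) = P-str ++ X-str ++ Y-str
  alpha ℓ (suc (suc k)) = alpha ℓ (suc k) ++ beta ℓ (suc k)
  beta ℓ k = concatMap (λ γ → alpha ℓ k ++ [ hlev k γ ]) (map suc (upTo ℓ))

  sG : (c ℓ : ℕ) → List Sym
  sG c ℓ = alpha ℓ c

  -- number of positions of s_G preceding the copy α^{(k)}_γ inside β^{(k)}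
  -- (so α^{(k)}_γ occupies positions copyOff+1 .. copyOff+|α^{(k)}|, 1-based)
  copyOff : (ℓ k γ : ℕ) → ℕ
  copyOff ℓ k γ = length (alpha ℓ k) + (γ ∸ 1) * suc (length (alpha ℓ k))

-- Parsings (positions are 1-based)

record Phrase : Set where
  constructor phrase
  field
    start : ℕ
    end   : ℕ
    src   : ℕ   -- b (only meaningful when the phrase has length ≥ 2)
open Phrase public

Tiles : ℕ → ℕ → List Phrase → Set
Tiles N k [] = k ≡ N
Tiles N k (ph ∷ φ) = start ph ≡ suc k × start ph ≤ end ph × Tiles N (end ph) φ

LZPhrase : List Sym → Phrase → Set
LZPhrase s ph =
  start ph ≡ end ph
  ⊎ (1 ≤ src ph × src ph < start ph
     × take (end ph ∸ start ph) (drop (src ph ∸ 1) s)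
       ≡ take (end ph ∸ start ph) (drop (start ph ∸ 1) s))

IsLZParsing : List Sym → List Phrase → Set
IsLZParsing s φ = Tiles (length s) 0 φ × All (LZPhrase s) φ

-- source position of p = a + t inside phrase (a,e,b): b + (t mod (a-b)).
-- (a - b written as suc (a ∸ b ∸ 1), equal to a - b since b < a)
srcPos : Phrase → ℕ → ℕ
srcPos ph p = src ph + ((p ∸ start ph) % suc (start ph ∸ src ph ∸ 1))

data Hop (φ : List Phrase) : ℕ → ℕ → Set where
  hop-last : ∀ {ph} → ph ∈ φ → Hop φ (end ph) 0
  hop-step : ∀ {ph p h} → ph ∈ φ → start ph ≤ p → p < end ph
           → Hop φ (srcPos ph p) h → Hop φ p (suc h)

phrasesIn : List Phrase → ℕ → ℕ → ℕ
phrasesIn φ lo hi = length (filterᵇ (λ ph → (lo ≤ᵇ start ph) ∧ (end ph ≤ᵇ hi)) φ)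

{-# OPTIONS --safe #-}
-- Write B = α^{(i+1)}. The separators #^{(i+1)}_γ and the last symbol #^{(i)}_ℓ of B occur only once
-- in s_G, and a symbol can sit strictly inside an LZ phrase only if it occurred before; so phrases
-- end at the end of B and at every #^{(i+1)}_γ, giving ℓ phrase ends inside β^{(i+1)}.
-- If for every j some copy γ has a phrase ending between x_j^γ and the copy of #^{(i)}_j that
-- follows it, these are ℓ further phrase ends and β^{(i+1)} contains at least 2ℓ phrases.
-- Otherwise fix j such that no copy has such an end. Then in every copy the phrase through x_j^γ
-- also covers that #^{(i)}_j without ending there, so it copies it from an earlier occurrence,
-- which lies at the same offset in an earlier copy of B (or in B itself). The phrase is thus shifted
-- by a whole number of copies, the source of x_j^γ is x_j^{γ'} for some γ' < γ (or x_j), and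
-- induction on γ gives hop(x_j^γ) > i + 2.
module Submission where

open import Defs
open import Data.Nat using (ℕ; zero; suc; _+_; _*_; _≤_; _<_; _∸_; z≤n; s≤s; _≟_; _≤?_; _≤ᵇ_)
open import Data.Nat.Properties
open import Data.Nat.DivMod using (m≤n⇒m%n≡m)
open import Data.Nat.Induction using (<-rec)
open import Data.List
  using (List; []; _∷_; _++_; [_]; length; take; drop; concat; concatMap; map; upTo; applyUpTo; allFin)
open import Data.List.Properties using (length-++; ++-assoc; ++-identityʳ; map-applyUpTo)
open import Data.List.Relation.Unary.All.Properties using (++⁺; concat⁺; map⁺; applyUpTo⁺₂)
open import Data.List.Membership.Propositional using (_∈_; find; lose)
open import Data.List.Relation.Unary.Any using (Any; here; there; any?)
open import Data.List.Relation.Unary.All as All using (All; []; _∷_)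
open import Data.Maybe using (Maybe; just; nothing)
open import Data.Product using (_×_; _,_; proj₁; proj₂; ∃-syntax)
open import Data.Sum using (_⊎_; inj₁; inj₂; [_,_]′)
open import Data.Empty using (⊥; ⊥-elim)
open import Data.Bool using (true; false; _∧_)
open import Data.Bool.Properties using (T-∧)
open import Function.Bundles using (module Equivalence)
open import Relation.Binary.PropositionalEquality
  using (_≡_; _≢_; refl; sym; trans; cong; cong₂; subst; module ≡-Reasoning)
open import Function using (_∘′_; id)
open import Algebra.Properties.CommutativeSemigroup +-commutativeSemigroup
  using () renaming (interchange to +-interchange; xy∙z≈xz∙y to +-right-comm)
open import Data.Nat.Tactic.RingSolver using (solve-∀)
open import Relation.Nullary using (Dec; yes; no; ¬_; ¬?)
open import Relation.Nullary.Decidable using (toSum; _×-dec_)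

module _ {A : Set} where

  -- 0-based, whereas phrase positions are 1-based: position p holds s ! (p ∸ 1).
  _!_ : List A → ℕ → Maybe A
  []       ! _     = nothing
  (x ∷ xs) ! zero  = just x
  (x ∷ xs) ! suc r = xs ! r

  !-++ˡ : ∀ xs ys {r} → r < length xs → (xs ++ ys) ! r ≡ xs ! r
  !-++ˡ (x ∷ xs) ys {zero}  _         = refl
  !-++ˡ (x ∷ xs) ys {suc r} (s≤s r<) = !-++ˡ xs ys r<

  !-++ʳ : ∀ xs ys r → (xs ++ ys) ! (length xs + r) ≡ ys ! r
  !-++ʳ []       ys r = refl
  !-++ʳ (x ∷ xs) ys r = !-++ʳ xs ys r

  !-++⁻ : ∀ xs ys r {σ} → (xs ++ ys) ! r ≡ just σ →
          (r < length xs × xs ! r ≡ just σ) ⊎ ∃[ r′ ] (r ≡ length xs + r′ × ys ! r′ ≡ just σ)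
  !-++⁻ []       ys r       eq = inj₂ (r , refl , eq)
  !-++⁻ (x ∷ xs) ys zero    eq = inj₁ (s≤s z≤n , eq)
  !-++⁻ (x ∷ xs) ys (suc r) eq with !-++⁻ xs ys r eq
  ... | inj₁ (r< , eq′)      = inj₁ (s≤s r< , eq′)
  ... | inj₂ (r′ , refl , eq′) = inj₂ (r′ , refl , eq′)

  !-take : ∀ xs {n r} → r < n → take n xs ! r ≡ xs ! r
  !-take []       {suc n} {r}     _        = refl
  !-take (x ∷ xs) {suc n} {zero}  _        = refl
  !-take (x ∷ xs) {suc n} {suc r} (s≤s r<) = !-take xs r<

  !-drop : ∀ xs k r → drop k xs ! r ≡ xs ! (k + r)
  !-drop xs       zero    r = refl
  !-drop []       (suc k) r = refl
  !-drop (x ∷ xs) (suc k) r = !-drop xs k r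

  !-take-drop : ∀ xs {n} k k′ {r} → take n (drop k xs) ≡ take n (drop k′ xs) → r < n →
                xs ! (k + r) ≡ xs ! (k′ + r)
  !-take-drop xs {n} k k′ {r} eq r<n = begin
    xs ! (k + r)             ≡⟨ sym (!-drop xs k r) ⟩
    drop k xs ! r            ≡⟨ sym (!-take (drop k xs) r<n) ⟩
    take n (drop k xs) ! r   ≡⟨ cong (_! r) eq ⟩
    take n (drop k′ xs) ! r  ≡⟨ !-take (drop k′ xs) r<n ⟩
    drop k′ xs ! r           ≡⟨ !-drop xs k′ r ⟩
    xs ! (k′ + r)            ∎
    where open ≡-Reasoning

  All-! : ∀ {P : A → Set} {xs} r {σ} → All P xs → xs ! r ≡ just σ → P σ
  All-! zero    (p ∷ _)  refl = p
  All-! (suc r) (_ ∷ ps) eq   = All-! r ps eq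

∑< : ℕ → (ℕ → ℕ) → ℕ
∑< zero    f = 0
∑< (suc n) f = ∑< n f + f n

syntax ∑< n (λ t → f) = ∑[ t < n ] f

∑-cong : ∀ n {f g : ℕ → ℕ} → (∀ {t} → t < n → f t ≡ g t) → ∑[ t < n ] f t ≡ ∑[ t < n ] g t
∑-cong zero    f≡g = refl
∑-cong (suc n) f≡g = cong₂ _+_ (∑-cong n (f≡g ∘′ m<n⇒m<1+n)) (f≡g ≤-refl)

∑-mono-≤ : ∀ n {f g : ℕ → ℕ} → (∀ {t} → t < n → f t ≤ g t) → ∑[ t < n ] f t ≤ ∑[ t < n ] g t
∑-mono-≤ zero    f≤g = z≤n
∑-mono-≤ (suc n) f≤g = +-mono-≤ (∑-mono-≤ n (λ t<n → f≤g (m<n⇒m<1+n t<n))) (f≤g ≤-refl)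

∑-zero : ∀ n → ∑[ t < n ] 0 ≡ 0
∑-zero zero    = refl
∑-zero (suc n) = cong (_+ 0) (∑-zero n)

∑-one : ∀ n → ∑[ t < n ] 1 ≡ n
∑-one zero    = refl
∑-one (suc n) = trans (cong (_+ 1) (∑-one n)) (+-comm n 1)

∑-distrib-+ : ∀ n (f g : ℕ → ℕ) → ∑[ t < n ] (f t + g t) ≡ ∑[ t < n ] f t + ∑[ t < n ] g t
∑-distrib-+ zero    f g = refl
∑-distrib-+ (suc n) f g rewrite ∑-distrib-+ n f g = +-interchange (∑< n f) (∑< n g) (f n) (g n)

∑-split : ∀ m n (f : ℕ → ℕ) → ∑[ t < m + n ] f t ≡ ∑[ t < m ] f t + ∑[ t < n ] f (m + t)
∑-split m zero    f = trans (cong (λ k → ∑< k f) (+-identityʳ m)) (sym (+-identityʳ _))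
∑-split m (suc n) f rewrite +-suc m n | ∑-split m n f = +-assoc (∑< m f) _ _

∑-blocks : ∀ n k (f : ℕ → ℕ) → ∑[ t < n * k ] f t ≡ ∑[ g < n ] ∑[ t < k ] f (g * k + t)
∑-blocks zero    k f = refl
∑-blocks (suc n) k f = begin
  ∑[ t < k + n * k ] f t                                          ≡⟨ cong (λ z → ∑< z f) (+-comm k (n * k)) ⟩
  ∑[ t < n * k + k ] f t                                          ≡⟨ ∑-split (n * k) k f ⟩
  ∑[ t < n * k ] f t + ∑[ t < k ] f (n * k + t)                   ≡⟨ cong (_+ ∑< k (λ t → f (n * k + t))) (∑-blocks n k f) ⟩
  ∑[ g < n ] ∑[ t < k ] f (g * k + t) + ∑[ t < k ] f (n * k + t)  ∎
  where open ≡-Reasoning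

∑-comm : ∀ n m (f : ℕ → ℕ → ℕ) → ∑[ a < n ] ∑[ b < m ] f a b ≡ ∑[ b < m ] ∑[ a < n ] f a b
∑-comm zero    m f = sym (∑-zero m)
∑-comm (suc n) m f rewrite ∑-comm n m f = sym (∑-distrib-+ m (λ b → ∑[ a < n ] f a b) (f n))

∑-term : ∀ n (f : ℕ → ℕ) {t} → t < n → f t ≤ ∑[ t < n ] f t
∑-term (suc n) f {t} (s≤s t≤n) with m≤n⇒m<n∨m≡n t≤n
... | inj₁ t<n  = ≤-trans (∑-term n f t<n) (m≤m+n _ _)
... | inj₂ refl = m≤n+m _ _

bounded-dichotomy : ∀ (P : ℕ → ℕ → Set) → (∀ j g → Dec (P j g)) → ∀ n m →
  ∃[ j ] (j < n × ∀ {g} → g < m → ¬ P j g) ⊎ (∀ {j} → j < n → ∃[ g ] (g < m × P j g))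
bounded-dichotomy P P? n m with anyUpTo? (λ j → allUpTo? (λ g → ¬? (P? j g)) m) n
... | yes (j , j<n , none) = inj₁ (j , j<n , none)
... | no  ¬some = inj₂ some
  where
  some : ∀ {j} → j < n → ∃[ g ] (g < m × P j g)
  some {j} j<n with anyUpTo? (P? j) m
  ... | yes found = found
  ... | no  ¬found = ⊥-elim (¬some (j , j<n , λ g<m Pjg → ¬found (_ , g<m , Pjg)))

-- Offsets in B B s₁ B s₂ ⋯ B sₙ with b = |B| and separators sₜ: copy γ of B, the leading one
-- being copy 0, starts after copyStart b γ symbols.
copyStart : ℕ → ℕ → ℕ
copyStart b zero    = 0
copyStart b (suc t) = b + t * suc b

copyStart-after-sep : ∀ b t → suc (copyStart b (suc t) + b) ≡ copyStart b (suc (suc t))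
copyStart-after-sep = rearrange
  where
  rearrange : ∀ b t → suc (b + t * suc b + b) ≡ b + suc t * suc b
  rearrange = solve-∀

copyStart-gap : ∀ b γ → copyStart b γ + b ≤ copyStart b (suc γ)
copyStart-gap b zero    = m≤m+n b 0
copyStart-gap b (suc t) = ≤-trans (n≤1+n _) (≤-reflexive (copyStart-after-sep b t))

copyStart-mono : ∀ b {γ γ′} → γ ≤ γ′ → copyStart b γ ≤ copyStart b γ′
copyStart-mono b {γ} {zero}   z≤n = ≤-refl
copyStart-mono b {γ} {suc γ′} γ≤ with m≤n⇒m<n∨m≡n γ≤
... | inj₂ refl       = ≤-refl
... | inj₁ (s≤s γ≤γ′) = ≤-trans (copyStart-mono b γ≤γ′) (≤-trans (m≤m+n _ _) (copyStart-gap b γ′))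

copyStart-gap-≤ : ∀ b {γ γ′} → γ′ ≤ γ → copyStart b γ′ + b ≤ copyStart b (suc γ)
copyStart-gap-≤ b {γ} γ′≤γ = ≤-trans (+-monoˡ-≤ b (copyStart-mono b γ′≤γ)) (copyStart-gap b γ)

copyStart-<⇒≤ : ∀ b {γ γ′} → copyStart b γ′ < copyStart b (suc γ) → γ′ ≤ γ
copyStart-<⇒≤ b {γ} {γ′} lt with γ′ ≤? γ
... | yes γ′≤γ = γ′≤γ
... | no  γ′≰γ = ⊥-elim (<⇒≱ lt (copyStart-mono b (≰⇒> γ′≰γ)))

∑-copies : ∀ b n (f : ℕ → ℕ) →
  ∑[ j < n ] ∑[ u < suc b ] f (copyStart b (suc j) + u) + f (copyStart b (suc n))
    ≤ ∑[ t < suc (copyStart b (suc n)) ] f t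
∑-copies b n f = begin
  ∑[ j < n ] ∑[ u < suc b ] f (b + j * suc b + u) + f (b + n * suc b)
    ≡⟨ cong₂ _+_ (∑-cong n (λ _ → ∑-cong (suc b) (λ _ → cong f (+-assoc b _ _))))
                 (cong (λ z → f (b + z)) (sym (+-identityʳ (n * suc b)))) ⟩
  ∑[ j < n ] ∑[ u < suc b ] f (b + (j * suc b + u)) + ∑[ t < 1 ] f (b + (n * suc b + t))
    ≡⟨ cong (_+ f (b + (n * suc b + 0))) (sym (∑-blocks n (suc b) (λ t → f (b + t)))) ⟩
  ∑[ t < n * suc b ] f (b + t) + ∑[ t < 1 ] f (b + (n * suc b + t))
    ≡⟨ sym (∑-split (n * suc b) 1 (λ t → f (b + t))) ⟩
  ∑[ t < n * suc b + 1 ] f (b + t)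
    ≤⟨ m≤n+m _ (∑< b f) ⟩
  ∑[ t < b ] f t + ∑[ t < n * suc b + 1 ] f (b + t)
    ≡⟨ sym (∑-split b (n * suc b + 1) f) ⟩
  ∑[ t < b + (n * suc b + 1) ] f t
    ≡⟨ cong (λ z → ∑< z f) (trans (cong (b +_) (+-comm (n * suc b) 1)) (+-suc b _)) ⟩
  ∑[ t < suc (b + n * suc b) ] f t ∎
  where open ≤-Reasoning

offset-in-window : ∀ {o c b x E} → c < x → o + x ≤ E → E ≤ suc (o + (c + b)) →
                   ∃[ u ] (u ≤ b × E ≡ suc (o + (c + u)))
offset-in-window {o} {c} {b} c<x lo≤E E≤hi
  with m≤n⇒∃[o]m+o≡n (≤-trans (≤-reflexive (sym (+-suc o c))) (≤-trans (+-monoʳ-≤ o c<x) lo≤E))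
... | u , refl =
  u , +-cancelˡ-≤ (suc (o + c)) u b (subst (suc (o + c) + u ≤_) (cong suc (sym (+-assoc o c b))) E≤hi) ,
  cong suc (+-assoc o c u)

module _ {A : Set} where

  sepCopies : List A → (ℕ → A) → ℕ → List A
  sepCopies B sep n = concat (applyUpTo (λ t → B ++ [ sep t ]) n)

  length-snoc : ∀ (B : List A) σ → length (B ++ [ σ ]) ≡ suc (length B)
  length-snoc B σ = trans (length-++ B) (+-comm (length B) 1)

  length-sepCopies : ∀ B sep n → length (sepCopies B sep n) ≡ n * suc (length B)
  length-sepCopies B sep zero    = refl
  length-sepCopies B sep (suc n) = trans (length-++ (B ++ [ sep 0 ]))
    (cong₂ _+_ (length-snoc B (sep 0)) (length-sepCopies B (sep ∘′ suc) n))

  !-sepCopies : ∀ B sep {n t m} → t < n → m < suc (length B) →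
                sepCopies B sep n ! (t * suc (length B) + m) ≡ (B ++ [ sep t ]) ! m
  !-sepCopies B sep {suc n} {zero}  {m} _ m≤B =
    !-++ˡ (B ++ [ sep 0 ]) _ (subst (m <_) (sym (length-snoc B (sep 0))) m≤B)
  !-sepCopies B sep {suc n} {suc t} {m} (s≤s t<n) m≤B = begin
    sepCopies B sep (suc n) ! (suc (length B) + t * suc (length B) + m)
      ≡⟨ cong (sepCopies B sep (suc n) !_) (trans (+-assoc (suc (length B)) _ m)
           (cong (_+ (t * suc (length B) + m)) (sym (length-snoc B (sep 0))))) ⟩
    sepCopies B sep (suc n) ! (length (B ++ [ sep 0 ]) + (t * suc (length B) + m))
      ≡⟨ !-++ʳ (B ++ [ sep 0 ]) _ _ ⟩
    sepCopies B (sep ∘′ suc) n ! (t * suc (length B) + m)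
      ≡⟨ !-sepCopies B (sep ∘′ suc) t<n m≤B ⟩
    (B ++ [ sep (suc t) ]) ! m ∎
    where open ≡-Reasoning

  !-sepCopies⁻ : ∀ B sep n r {σ} → sepCopies B sep n ! r ≡ just σ →
    ∃[ t ] ∃[ m ] (t < n × m < suc (length B) × r ≡ t * suc (length B) + m × (B ++ [ sep t ]) ! m ≡ just σ)
  !-sepCopies⁻ B sep (suc n) r eq with !-++⁻ (B ++ [ sep 0 ]) _ r eq
  ... | inj₁ (r< , eq′) = 0 , r , s≤s z≤n , subst (r <_) (length-snoc B (sep 0)) r< , refl , eq′
  ... | inj₂ (r′ , refl , eq′) with !-sepCopies⁻ B (sep ∘′ suc) n r′ eq′
  ...   | t , m , t<n , m≤B , refl , eq″ = suc t , m , s≤s t<n , m≤B ,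
          trans (cong (_+ (t * suc (length B) + m)) (length-snoc B (sep 0))) (sym (+-assoc (suc (length B)) _ m)) ,
          eq″

  !-snoc⁻ : ∀ (B : List A) σ′ m {σ} → (B ++ [ σ′ ]) ! m ≡ just σ →
            (m < length B × B ! m ≡ just σ) ⊎ (m ≡ length B × σ ≡ σ′)
  !-snoc⁻ B σ′ m eq with !-++⁻ B [ σ′ ] m eq
  ... | inj₁ in-B                  = inj₁ in-B
  ... | inj₂ (zero , m≡ , refl)    = inj₂ (trans m≡ (+-identityʳ _) , refl)
  ... | inj₂ (suc _ , _ , ())

  module Layout (B : List A) (sep : ℕ → A) (n : ℕ) where

    withCopies : List A
    withCopies = B ++ sepCopies B sep n

    length-withCopies : length withCopies ≡ copyStart (length B) (suc n)
    length-withCopies = trans (length-++ B) (cong (length B +_) (length-sepCopies B sep n))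

    !-copy : ∀ {γ m} → γ ≤ n → m < length B → withCopies ! (copyStart (length B) γ + m) ≡ B ! m
    !-copy {zero}  {m} _ m<B = !-++ˡ B _ m<B
    !-copy {suc t} {m} t<n m<B = begin
      withCopies ! (length B + t * suc (length B) + m)    ≡⟨ cong (withCopies !_) (+-assoc (length B) _ m) ⟩
      withCopies ! (length B + (t * suc (length B) + m))  ≡⟨ !-++ʳ B _ _ ⟩
      sepCopies B sep n ! (t * suc (length B) + m)        ≡⟨ !-sepCopies B sep t<n (m≤n⇒m≤1+n m<B) ⟩
      (B ++ [ sep t ]) ! m                                ≡⟨ !-++ˡ B _ m<B ⟩
      B ! m                                               ∎
      where open ≡-Reasoning

    !-sep : ∀ {t} → t < n → withCopies ! (copyStart (length B) (suc t) + length B) ≡ just (sep t)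
    !-sep {t} t<n = begin
      withCopies ! (length B + t * suc (length B) + length B)    ≡⟨ cong (withCopies !_) (+-assoc (length B) _ _) ⟩
      withCopies ! (length B + (t * suc (length B) + length B))  ≡⟨ !-++ʳ B _ _ ⟩
      sepCopies B sep n ! (t * suc (length B) + length B)        ≡⟨ !-sepCopies B sep t<n ≤-refl ⟩
      (B ++ [ sep t ]) ! length B                                ≡⟨ cong ((B ++ [ sep t ]) !_) (sym (+-identityʳ _)) ⟩
      (B ++ [ sep t ]) ! (length B + 0)                          ≡⟨ !-++ʳ B _ 0 ⟩
      just (sep t)                                               ∎
      where open ≡-Reasoning

    !-withCopies⁻ : ∀ r {σ} → withCopies ! r ≡ just σ →
      ∃[ γ ] ∃[ m ] (γ ≤ n × m < length B × r ≡ copyStart (length B) γ + m × B ! m ≡ just σ)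
      ⊎ ∃[ t ] (t < n × r ≡ copyStart (length B) (suc t) + length B × σ ≡ sep t)
    !-withCopies⁻ r eq with !-++⁻ B _ r eq
    ... | inj₁ (r<B , eq′) = inj₁ (0 , r , z≤n , r<B , refl , eq′)
    ... | inj₂ (r′ , refl , eq′) with !-sepCopies⁻ B sep n r′ eq′
    ...   | t , m , t<n , _ , refl , eq″ with !-snoc⁻ B (sep t) m eq″
    ...     | inj₁ (m<B , eq‴)  = inj₁ (suc t , m , t<n , m<B , sym (+-assoc (length B) _ m) , eq‴)
    ...     | inj₂ (refl , refl) = inj₂ (t , t<n , sym (+-assoc (length B) _ (length B)) , refl)

    sep-index< : ∀ {t} → t < n → copyStart (length B) (suc t) + length B < length withCopies
    sep-index< {t} t<n = begin-strict
      copyStart (length B) (suc t) + length B  <⟨ ≤-reflexive (copyStart-after-sep (length B) t) ⟩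
      copyStart (length B) (suc (suc t))       ≤⟨ copyStart-mono (length B) (s≤s t<n) ⟩
      copyStart (length B) (suc n)             ≡⟨ sym length-withCopies ⟩
      length withCopies                        ∎
      where open ≤-Reasoning

NonFinal : Phrase → ℕ → Set
NonFinal ph p = start ph ≤ p × p < end ph

BoundaryAfter : List Phrase → ℕ → Set
BoundaryAfter φ p = ∀ {ph} → ph ∈ φ → ¬ NonFinal ph p

PhraseEndIn : List Phrase → ℕ → ℕ → Set
PhraseEndIn φ lo hi = Any (λ ph → lo ≤ end ph × end ph ≤ hi) φ

phraseEndIn? : ∀ φ lo hi → Dec (PhraseEndIn φ lo hi)
phraseEndIn? φ lo hi = any? (λ ph → lo ≤? end ph ×-dec end ph ≤? hi) φ

phrase-containing : ∀ {N k φ p} → Tiles N k φ → k < p → p ≤ N →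
                    ∃[ ph ] (ph ∈ φ × start ph ≤ p × p ≤ end ph)
phrase-containing {φ = []}     refl k<p p≤N = ⊥-elim (<⇒≱ k<p p≤N)
phrase-containing {φ = ph ∷ φ} {p} (refl , _ , tiles) k<p p≤N with p ≤? end ph
... | yes p≤e = ph , here refl , k<p , p≤e
... | no  p≰e with phrase-containing tiles (≰⇒> p≰e) p≤N
...   | ph′ , ph′∈φ , bounds = ph′ , there ph′∈φ , bounds

boundary⇒phrase-end : ∀ {N k φ p} → Tiles N k φ → k < p → p ≤ N → BoundaryAfter φ p →
                      ∃[ ph ] (ph ∈ φ × end ph ≡ p)
boundary⇒phrase-end tiles k<p p≤N boundary with phrase-containing tiles k<p p≤N
... | ph , ph∈φ , st≤p , p≤e with m≤n⇒m<n∨m≡n p≤e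
...   | inj₁ p<e  = ⊥-elim (boundary ph∈φ (st≤p , p<e))
...   | inj₂ p≡e  = ph , ph∈φ , sym p≡e

lz-shift : ∀ {s ph q} → LZPhrase s ph → NonFinal ph (suc q) →
  ∃[ d ] (0 < d × src ph + d ≡ start ph × ∃[ r ] (r + d ≡ q × s ! r ≡ s ! q))
lz-shift (inj₁ a≡e) (a≤ , <e) = ⊥-elim (<-irrefl a≡e (≤-<-trans a≤ <e))
lz-shift {s} {phrase (suc a₀) e₀ (suc b₀)} (inj₂ (_ , s≤s b₀<a₀ , copy)) (s≤s a₀≤q , q<e)
  with m≤n⇒∃[o]m+o≡n b₀<a₀
... | o , refl with m≤n⇒∃[o]m+o≡n a₀≤q
...   | t , refl =
  suc o , s≤s z≤n , cong suc (+-suc b₀ o) , b₀ + t , reorder b₀ o t , !-take-drop s b₀ (suc b₀ + o) copy t<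
  where
  reorder : ∀ b o t → b + t + suc o ≡ suc b + o + t
  reorder = solve-∀
  t< : t < e₀ ∸ suc (suc b₀ + o)
  t< = m+n≤o⇒m≤o∸n (suc t) (subst (_≤ e₀) (reorder′ b₀ o t) q<e)
    where
    reorder′ : ∀ b o t → suc (suc (suc b + o + t)) ≡ suc t + suc (suc b + o)
    reorder′ = solve-∀

srcPos-shift : ∀ ph {d p} → src ph + d ≡ start ph → 0 < d → start ph ≤ p → p < start ph + d →
               srcPos ph p + d ≡ p
srcPos-shift (phrase a e₀ b) {suc d′} refl _ a≤p p<a+d with m≤n⇒∃[o]m+o≡n a≤p
... | t , refl
  rewrite m+n∸m≡n (b + suc d′) t | m+n∸m≡n b (suc d′)
        | m≤n⇒m%n≡m (≤-pred (+-cancelˡ-< (b + suc d′) t (suc d′) p<a+d))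
  = +-right-comm b t (suc d′)

first-occurrence⇒boundary : ∀ {s φ r₀ σ} → All (LZPhrase s) φ → s ! r₀ ≡ just σ →
  (∀ r → r < r₀ → s ! r ≢ just σ) → BoundaryAfter φ (suc r₀)
first-occurrence⇒boundary lz at-r₀ first ph∈φ nonfinal with lz-shift (All.lookup lz ph∈φ) nonfinal
... | d , 0<d , _ , r , r+d≡r₀ , at-r = first r (subst (r <_) r+d≡r₀ (m<m+n r 0<d)) (trans at-r at-r₀)

δ : ℕ → ℕ → ℕ
δ a b with a ≟ b
... | yes _ = 1
... | no  _ = 0

δ-refl : ∀ a → δ a a ≡ 1
δ-refl a with a ≟ a
... | yes _   = refl
... | no  a≢a = ⊥-elim (a≢a refl)

δ-≢ : ∀ {a b} → a ≢ b → δ a b ≡ 0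
δ-≢ {a} {b} a≢b with a ≟ b
... | yes a≡b = ⊥-elim (a≢b a≡b)
... | no  _   = refl

∑-δ≤1 : ∀ a lo n → ∑[ t < n ] δ a (lo + t) ≤ 1
∑-δ≤1 a lo zero    = z≤n
∑-δ≤1 a lo (suc n) with toSum (a ≟ lo + n)
... | inj₂ a≢ = ≤-trans (≤-reflexive (trans (cong (∑< n (λ t → δ a (lo + t)) +_) (δ-≢ a≢)) (+-identityʳ _)))
                       (∑-δ≤1 a lo n)
... | inj₁ refl = ≤-reflexive (begin
  ∑[ t < n ] δ (lo + n) (lo + t) + δ (lo + n) (lo + n)
    ≡⟨ cong₂ _+_ (∑-cong n (λ t<n → δ-≢ (>⇒≢ (+-monoʳ-< lo t<n)))) (δ-refl (lo + n)) ⟩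
  ∑[ t < n ] 0 + 1
    ≡⟨ cong (_+ 1) (∑-zero n) ⟩
  1 ∎)
  where open ≡-Reasoning

∑-δ-outside : ∀ {a} lo n → ¬ (lo ≤ a × a < lo + n) → ∑[ t < n ] δ a (lo + t) ≡ 0
∑-δ-outside {a} lo n outside =
  trans (∑-cong n (λ {t} t<n → δ-≢ (λ { refl → outside (m≤m+n lo t , +-monoʳ-< lo t<n) }))) (∑-zero n)

endsAt : List Phrase → ℕ → ℕ
endsAt []       p = 0
endsAt (ph ∷ φ) p = δ (end ph) p + endsAt φ p

endsAt-end : ∀ {φ ph} → ph ∈ φ → 1 ≤ endsAt φ (end ph)
endsAt-end {ph ∷ φ} (here refl) = ≤-trans (≤-reflexive (sym (δ-refl (end ph)))) (m≤m+n _ _)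
endsAt-end {_ ∷ φ}  (there ph∈φ) = ≤-trans (endsAt-end ph∈φ) (m≤n+m _ _)

phrasesIn-∷-≤ : ∀ ph φ lo hi → phrasesIn φ lo hi ≤ phrasesIn (ph ∷ φ) lo hi
phrasesIn-∷-≤ ph φ lo hi with (lo ≤ᵇ start ph) ∧ (end ph ≤ᵇ hi)
... | true  = n≤1+n _
... | false = ≤-refl

phrasesIn-∷ : ∀ {ph} φ {lo hi} → lo ≤ start ph → end ph ≤ hi →
              phrasesIn (ph ∷ φ) lo hi ≡ suc (phrasesIn φ lo hi)
phrasesIn-∷ {ph} φ {lo} {hi} lo≤st en≤hi
  with (lo ≤ᵇ start ph) ∧ (end ph ≤ᵇ hi) | Equivalence.from T-∧ (≤⇒≤ᵇ lo≤st , ≤⇒≤ᵇ en≤hi)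
... | true | _ = refl

endsAt-window≤phrasesIn : ∀ φ {lo} n → (∀ {ph} → ph ∈ φ → lo ≤ end ph → lo ≤ start ph) →
                          ∑[ t < suc n ] endsAt φ (lo + t) ≤ phrasesIn φ lo (lo + n)
endsAt-window≤phrasesIn []       n _ = ≤-reflexive (cong (_+ 0) (∑-zero n))
endsAt-window≤phrasesIn (ph ∷ φ) {lo} n starts-late
  rewrite ∑-distrib-+ (suc n) (λ t → δ (end ph) (lo + t)) (λ t → endsAt φ (lo + t))
  with lo ≤? end ph ×-dec end ph ≤? lo + n
... | yes (lo≤en , en≤hi) = begin
  ∑[ t < suc n ] δ (end ph) (lo + t) + ∑[ t < suc n ] endsAt φ (lo + t)
    ≤⟨ +-mono-≤ (∑-δ≤1 (end ph) lo (suc n)) (endsAt-window≤phrasesIn φ n (starts-late ∘′ there)) ⟩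
  suc (phrasesIn φ lo (lo + n))
    ≡⟨ sym (phrasesIn-∷ φ (starts-late (here refl) lo≤en) en≤hi) ⟩
  phrasesIn (ph ∷ φ) lo (lo + n) ∎
  where open ≤-Reasoning hiding (start)
... | no not-inside = begin
  ∑[ t < suc n ] δ (end ph) (lo + t) + ∑[ t < suc n ] endsAt φ (lo + t)
    ≡⟨ cong (_+ ∑[ t < suc n ] endsAt φ (lo + t)) (∑-δ-outside lo (suc n) outside) ⟩
  ∑[ t < suc n ] endsAt φ (lo + t)
    ≤⟨ endsAt-window≤phrasesIn φ n (starts-late ∘′ there) ⟩
  phrasesIn φ lo (lo + n)
    ≤⟨ phrasesIn-∷-≤ ph φ lo (lo + n) ⟩
  phrasesIn (ph ∷ φ) lo (lo + n) ∎
  where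
  open ≤-Reasoning hiding (start)
  outside : ¬ (lo ≤ end ph × end ph < lo + suc n)
  outside (lo≤en , en<) = not-inside (lo≤en , ≤-pred (subst (end ph <_) (+-suc lo n) en<))

level : Sym → ℕ
level (hlev k _) = suc k
level _          = 0

Below : ℕ → List Sym → Set
Below k = All (λ σ → level σ ≤ k)

module Levels (k : ℕ) (B : List Sym) (B-below : Below k B) (n : ℕ) where
  open Layout B (hlev k ∘′ suc) n public

  !-separator⁻ : ∀ {r γ} → withCopies ! r ≡ just (hlev k γ) →
                 ∃[ t ] (t < n × γ ≡ suc t × r ≡ copyStart (length B) (suc t) + length B)
  !-separator⁻ {r} at-r with !-withCopies⁻ r at-r
  ... | inj₁ (_ , m , _ , _ , _ , at-m) = ⊥-elim (<-irrefl refl (All-! m B-below at-m))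
  ... | inj₂ (t , t<n , r≡ , refl)       = t , t<n , refl , r≡

  !-below⁻ : ∀ {r σ} → withCopies ! r ≡ just σ → level σ ≤ k →
             ∃[ γ ] ∃[ m ] (γ ≤ n × m < length B × r ≡ copyStart (length B) γ + m × B ! m ≡ just σ)
  !-below⁻ {r} at-r σ-below with !-withCopies⁻ r at-r
  ... | inj₁ in-copy             = in-copy
  ... | inj₂ (_ , _ , _ , refl) = ⊥-elim (<-irrefl refl σ-below)

  withCopies-below : Below (suc k) withCopies
  withCopies-below = ++⁺ (All.map m≤n⇒m≤1+n B-below)
                (concat⁺ (applyUpTo⁺₂ _ n (λ t → ++⁺ (All.map m≤n⇒m≤1+n B-below) (≤-refl ∷ []))))

module Construction (G : Graph) (ℓ : ℕ) where

  sepCopies-beta : ∀ k → beta G ℓ k ≡ sepCopies (alpha G ℓ k) (hlev k ∘′ suc) ℓ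
  sepCopies-beta k = cong concat (trans (cong (map copy) (map-applyUpTo id suc ℓ)) (map-applyUpTo suc copy ℓ))
    where
    copy : ℕ → List Sym
    copy γ = alpha G ℓ k ++ [ hlev k γ ]

  alpha-suc : ∀ k → alpha G ℓ (suc (suc k)) ≡ Layout.withCopies (alpha G ℓ (suc k)) (hlev (suc k) ∘′ suc) ℓ
  alpha-suc k = cong (alpha G ℓ (suc k) ++_) (sepCopies-beta (suc k))

  alpha-below : ∀ k → Below k (alpha G ℓ k)
  alpha-below zero          = []
  alpha-below (suc zero)    =
    ++⁺ (++⁺ (concatMap-below (upTo n) (λ _ → z≤n ∷ z≤n ∷ []))
             (concatMap-below (upTo m) (λ _ → z≤n ∷ z≤n ∷ [])))
        (++⁺ (concatMap-below (upTo n) (λ _ → z≤n ∷ z≤n ∷ z≤n ∷ []))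
             (concatMap-below (allFin m) (λ _ → z≤n ∷ z≤n ∷ z≤n ∷ z≤n ∷ z≤n ∷ z≤n ∷ z≤n ∷ z≤n ∷ z≤n ∷ [])))
    where
    open Graph G
    concatMap-below : ∀ {X : Set} {f : X → List Sym} xs → (∀ x → Below 1 (f x)) → Below 1 (concatMap f xs)
    concatMap-below xs f-below = concat⁺ (map⁺ (All.universal f-below xs))
  alpha-below (suc (suc k)) = subst (Below (suc (suc k))) (sym (alpha-suc k))
    (Levels.withCopies-below (suc k) (alpha G ℓ (suc k)) (alpha-below (suc k)) ℓ)

  alpha-prefix : ∀ {k c} → suc k ≤ c → ∃[ ys ] alpha G ℓ c ≡ alpha G ℓ (suc k) ++ ys
  alpha-prefix {k} k<c with m≤n⇒∃[o]m+o≡n k<c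
  ... | o , refl = prefix-by o
    where
    prefix-by : ∀ o → ∃[ ys ] alpha G ℓ (suc k + o) ≡ alpha G ℓ (suc k) ++ ys
    prefix-by zero    = [] , trans (cong (alpha G ℓ) (+-identityʳ (suc k))) (sym (++-identityʳ _))
    prefix-by (suc o) with prefix-by o
    ... | ys , eq = ys ++ beta G ℓ (suc k + o) , (begin
      alpha G ℓ (suc k + suc o)                       ≡⟨ cong (alpha G ℓ) (+-suc (suc k) o) ⟩
      alpha G ℓ (suc k + o) ++ beta G ℓ (suc k + o)   ≡⟨ cong (_++ beta G ℓ (suc k + o)) eq ⟩
      (alpha G ℓ (suc k) ++ ys) ++ beta G ℓ (suc k + o) ≡⟨ ++-assoc (alpha G ℓ (suc k)) ys _ ⟩
      alpha G ℓ (suc k) ++ ys ++ beta G ℓ (suc k + o) ∎)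
      where open ≡-Reasoning

module HopPropagation (ℓ₀ i : ℕ) (A B C : List Sym) (A-below : Below i A)
  (B-layout : B ≡ Layout.withCopies A (hlev i ∘′ suc) (suc ℓ₀))
  (C-layout : C ≡ Layout.withCopies B (hlev (suc i) ∘′ suc) (suc ℓ₀))
  {s : List Sym} {φ : List Phrase} (C-prefix : ∃[ ys ] s ≡ C ++ ys)
  (tiles : Tiles (length s) 0 φ) (lz : All (LZPhrase s) φ) where

  ℓ : ℕ
  ℓ = suc ℓ₀

  a L M : ℕ
  a = length A
  L = length B
  M = length C

  module InB = Levels i A A-below ℓ

  B-below : Below (suc i) B
  B-below = subst (Below (suc i)) (sym B-layout) InB.withCopies-below

  module InC = Levels (suc i) B B-below ℓ

  -- 0-based index in B of the separator #^{(i)}_{j+1}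
  sepA : ℕ → ℕ
  sepA j = copyStart a (suc j) + a

  EndBeforeSeparator : ℕ → ℕ → ℕ → Set
  EndBeforeSeparator x j g = PhraseEndIn φ (copyStart L (suc g) + x) (suc (copyStart L (suc g) + sepA j))

  L≡ : L ≡ copyStart a (suc ℓ)
  L≡ = trans (cong length B-layout) InB.length-withCopies

  M≡ : M ≡ copyStart L (suc ℓ)
  M≡ = trans (cong length C-layout) InC.length-withCopies

  M≤N : M ≤ length s
  M≤N = ≤-trans (m≤m+n M _) (≤-reflexive (sym (trans (cong length (proj₂ C-prefix)) (length-++ C))))

  s!≡C! : ∀ {r} → r < M → s ! r ≡ InC.withCopies ! r
  s!≡C! {r} r<M = trans (cong (_! r) (proj₂ C-prefix)) (trans (!-++ˡ C _ r<M) (cong (_! r) C-layout))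

  sepA<L : ∀ {j} → j < ℓ → sepA j < L
  sepA<L {j} j<ℓ = subst (sepA j <_) (sym (cong length B-layout)) (InB.sep-index< j<ℓ)

  copy-index<M : ∀ {γ m} → γ ≤ ℓ → m < L → copyStart L γ + m < M
  copy-index<M {γ} {m} γ≤ℓ m<L = begin-strict
    copyStart L γ + m    <⟨ +-monoʳ-< (copyStart L γ) m<L ⟩
    copyStart L γ + L    ≤⟨ copyStart-gap-≤ L γ≤ℓ ⟩
    copyStart L (suc ℓ)  ≡⟨ sym M≡ ⟩
    M                    ∎
    where open ≤-Reasoning

  !-sepA : ∀ {γ j} → γ ≤ ℓ → j < ℓ → s ! (copyStart L γ + sepA j) ≡ just (hlev i (suc j))
  !-sepA {γ} {j} γ≤ℓ j<ℓ = begin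
    s ! (copyStart L γ + sepA j)               ≡⟨ s!≡C! (copy-index<M γ≤ℓ (sepA<L j<ℓ)) ⟩
    InC.withCopies ! (copyStart L γ + sepA j)  ≡⟨ InC.!-copy γ≤ℓ (sepA<L j<ℓ) ⟩
    B ! sepA j                                 ≡⟨ cong (_! sepA j) B-layout ⟩
    InB.withCopies ! sepA j                    ≡⟨ InB.!-sep j<ℓ ⟩
    just (hlev i (suc j))                      ∎
    where open ≡-Reasoning

  !-sepA⁻ : ∀ {r j} → r < M → s ! r ≡ just (hlev i (suc j)) →
            ∃[ γ ] (γ ≤ ℓ × r ≡ copyStart L γ + sepA j)
  !-sepA⁻ r<M at-r with InC.!-below⁻ (trans (sym (s!≡C! r<M)) at-r) ≤-refl
  ... | γ , m , γ≤ℓ , _ , r≡ , at-m with InB.!-separator⁻ (trans (cong (_! m) (sym B-layout)) at-m)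
  ...   | _ , _ , refl , refl = γ , γ≤ℓ , r≡

  unique⇒boundary : ∀ {q σ} → q < M → s ! q ≡ just σ →
                    (∀ {r} → r < M → s ! r ≡ just σ → q ≤ r) → BoundaryAfter φ (suc q)
  unique⇒boundary q<M at-q only = first-occurrence⇒boundary lz at-q
    (λ r r<q at-r → <⇒≱ r<q (only (<-trans r<q q<M) at-r))

  boundary-after-copy : ∀ {γ} → γ ≤ ℓ → BoundaryAfter φ (copyStart L (suc γ))
  boundary-after-copy {zero} _ = subst (BoundaryAfter φ) last-of-B
    (unique⇒boundary (copy-index<M z≤n (sepA<L ≤-refl)) (!-sepA z≤n ≤-refl) only)
    where
    last-of-B : suc (sepA ℓ₀) ≡ L + 0
    last-of-B = trans (copyStart-after-sep a ℓ₀) (trans (sym L≡) (sym (+-identityʳ L)))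
    only : ∀ {r} → r < M → s ! r ≡ just (hlev i ℓ) → sepA ℓ₀ ≤ r
    only r<M at-r with !-sepA⁻ r<M at-r
    ... | γ , _ , refl = m≤n+m (sepA ℓ₀) (copyStart L γ)
  boundary-after-copy {suc g} g<ℓ = subst (BoundaryAfter φ) (copyStart-after-sep L g)
    (unique⇒boundary q<M (trans (s!≡C! q<M) (InC.!-sep g<ℓ)) only)
    where
    q<M : copyStart L (suc g) + L < M
    q<M = subst (copyStart L (suc g) + L <_) (sym (cong length C-layout)) (InC.sep-index< g<ℓ)
    only : ∀ {r} → r < M → s ! r ≡ just (hlev (suc i) (suc g)) → copyStart L (suc g) + L ≤ r
    only r<M at-r with InC.!-separator⁻ (trans (sym (s!≡C! r<M)) at-r)
    ... | _ , _ , refl , refl = ≤-refl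

  module _ {j g : ℕ} (j<ℓ : j < ℓ) (g<ℓ : g < ℓ) where

    private
      off hash : ℕ
      off  = copyStart L (suc g)
      hash = off + sepA j

      hash<M : hash < M
      hash<M = copy-index<M g<ℓ (sepA<L j<ℓ)

    phrase-across-separator : ∀ {x} → 0 < x → x ≤ sepA j → ¬ EndBeforeSeparator x j g →
      ∃[ ph ] (ph ∈ φ × off < start ph × NonFinal ph (off + x) × suc hash < end ph)
    phrase-across-separator {x} 0<x x≤ no-end
      with phrase-containing tiles (≤-trans 0<x (m≤n+m x off))
                                   (≤-trans (+-monoʳ-≤ off x≤) (≤-trans (<⇒≤ hash<M) M≤N))
    ... | ph , ph∈φ , st≤X , X≤en = ph , ph∈φ , off<st , (st≤X , X<en) , hash<en
      where
      hash<en : suc hash < end ph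
      hash<en with end ph ≤? suc hash
      ... | yes en≤ = ⊥-elim (no-end (lose ph∈φ (X≤en , en≤)))
      ... | no  en≰ = ≰⇒> en≰
      X<en : off + x < end ph
      X<en = ≤-<-trans (+-monoʳ-≤ off x≤) (<-trans (n<1+n hash) hash<en)
      off<st : off < start ph
      off<st with start ph ≤? off
      ... | no  st≰ = ≰⇒> st≰
      ... | yes st≤ = ⊥-elim (boundary-after-copy (<⇒≤ g<ℓ) ph∈φ (st≤ , <-trans (m<m+n off 0<x) X<en))

    -- The separator #^{(i)}_{j+1} inside the phrase can only be copied from the same separator in
    -- an earlier copy of B, so the phrase is shifted by the distance between two copies of B.
    source-in-earlier-copy : ∀ {x ph} → x ≤ sepA j → ph ∈ φ → off < start ph → NonFinal ph (off + x) →
      suc hash < end ph → ∃[ γ ] (γ ≤ g × srcPos ph (off + x) ≡ copyStart L γ + x)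
    source-in-earlier-copy {x} {ph} x≤ ph∈φ off<st (st≤X , _) hash<en
      with lz-shift (All.lookup lz ph∈φ) (≤-trans st≤X (≤-trans (+-monoʳ-≤ off x≤) (n≤1+n hash)) , hash<en)
    ... | d , 0<d , src+d≡st , r , r+d≡hash , at-r = from-earlier-separator
      (!-sepA⁻ (<-trans (subst (r <_) r+d≡hash (m<m+n r 0<d)) hash<M) (trans at-r (!-sepA g<ℓ j<ℓ)))
      where
      from-earlier-separator : ∃[ γ ] (γ ≤ ℓ × r ≡ copyStart L γ + sepA j) →
                               ∃[ γ ] (γ ≤ g × srcPos ph (off + x) ≡ copyStart L γ + x)
      from-earlier-separator (γ , _ , r≡) = γ , γ≤g , srcPos≡
        where
        shift : copyStart L γ + d ≡ off
        shift = +-cancelʳ-≡ (sepA j) _ _ (begin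
          copyStart L γ + d + sepA j  ≡⟨ +-right-comm (copyStart L γ) d (sepA j) ⟩
          copyStart L γ + sepA j + d  ≡⟨ cong (_+ d) (sym r≡) ⟩
          r + d                       ≡⟨ r+d≡hash ⟩
          off + sepA j                ∎)
          where open ≡-Reasoning
        γ≤g : γ ≤ g
        γ≤g = copyStart-<⇒≤ L (subst (copyStart L γ <_) shift (m<m+n (copyStart L γ) 0<d))
        L≤d : L ≤ d
        L≤d = +-cancelˡ-≤ (copyStart L γ) L d (subst (copyStart L γ + L ≤_) (sym shift) (copyStart-gap-≤ L γ≤g))
        X<st+d : off + x < start ph + d
        X<st+d = begin-strict
          off + x       <⟨ +-monoʳ-< off (≤-<-trans x≤ (sepA<L j<ℓ)) ⟩
          off + L       ≤⟨ +-monoʳ-≤ off L≤d ⟩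
          off + d       <⟨ +-monoˡ-< d off<st ⟩
          start ph + d  ∎
          where open ≤-Reasoning hiding (start)
        srcPos≡ : srcPos ph (off + x) ≡ copyStart L γ + x
        srcPos≡ = +-cancelʳ-≡ d _ _ (trans (srcPos-shift ph src+d≡st 0<d st≤X X<st+d)
                    (trans (cong (_+ x) (sym shift)) (+-right-comm (copyStart L γ) d x)))

  hop-in-copies : ∀ {j x h₀} → j < ℓ → 0 < x → x ≤ sepA j → Hop φ x h₀ → i + 1 < h₀ →
    (∀ {g} → g < ℓ → ¬ EndBeforeSeparator x j g) →
    ∀ g → g < ℓ → ∃[ h ] (Hop φ (copyStart L (suc g) + x) h × i + 2 < h)
  hop-in-copies {j} {x} {h₀} j<ℓ 0<x x≤ hop₀ deep no-end = <-rec _ step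
    where
    Deep : ℕ → Set
    Deep g = ∃[ h ] (Hop φ (copyStart L (suc g) + x) h × i + 2 < h)

    step : ∀ g → (∀ {g′} → g′ < g → g′ < ℓ → Deep g′) → g < ℓ → Deep g
    step g earlier g<ℓ =
      let ph , ph∈φ , off<st , nonfinal , hash<en = phrase-across-separator j<ℓ g<ℓ 0<x x≤ (no-end g<ℓ)
      in  deeper-than-source ph∈φ nonfinal (source-in-earlier-copy j<ℓ g<ℓ x≤ ph∈φ off<st nonfinal hash<en)
      where
      deeper-than-source : ∀ {ph} → ph ∈ φ → NonFinal ph (copyStart L (suc g) + x) →
        ∃[ γ ] (γ ≤ g × srcPos ph (copyStart L (suc g) + x) ≡ copyStart L γ + x) → Deep g
      deeper-than-source ph∈φ (st≤X , X<en) (zero , _ , src≡) =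
        suc h₀ , hop-step ph∈φ st≤X X<en (subst (λ p → Hop φ p h₀) (sym src≡) hop₀) ,
        s≤s (subst (_≤ h₀) (sym (+-suc i 1)) deep)
      deeper-than-source ph∈φ (st≤X , X<en) (suc g′ , g′<g , src≡) =
        let h , hop , deeper = earlier g′<g (<-trans g′<g g<ℓ)
        in  suc h , hop-step ph∈φ st≤X X<en (subst (λ p → Hop φ p h) (sym src≡) hop) , m<n⇒m<1+n deeper

  endsIn-copy : ℕ → ℕ → ℕ
  endsIn-copy g t = endsAt φ (suc (copyStart L (suc g) + t))

  endsIn-copy-of-A : ℕ → ℕ → ℕ
  endsIn-copy-of-A g j = ∑[ u < suc a ] endsIn-copy g (copyStart a (suc j) + u)

  boundary⇒endsAt : ∀ {p} → 0 < p → p ≤ M → BoundaryAfter φ p → 1 ≤ endsAt φ p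
  boundary⇒endsAt 0<p p≤M boundary =
    let ph , ph∈φ , en≡p = boundary⇒phrase-end tiles 0<p (≤-trans p≤M M≤N) boundary
    in  subst (λ q → 1 ≤ endsAt φ q) en≡p (endsAt-end ph∈φ)

  ends-per-copy : ∀ {g} → g < ℓ → ∑[ j < ℓ ] endsIn-copy-of-A g j + 1 ≤ ∑[ t < suc L ] endsIn-copy g t
  ends-per-copy {g} g<ℓ = begin
    ∑[ j < ℓ ] endsIn-copy-of-A g j + 1
      ≤⟨ +-monoʳ-≤ _ separator-ends ⟩
    ∑[ j < ℓ ] endsIn-copy-of-A g j + endsIn-copy g L
      ≡⟨ cong (λ z → ∑< ℓ (endsIn-copy-of-A g) + endsIn-copy g z) L≡ ⟩
    ∑[ j < ℓ ] endsIn-copy-of-A g j + endsIn-copy g (copyStart a (suc ℓ))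
      ≤⟨ ∑-copies a ℓ (endsIn-copy g) ⟩
    ∑[ t < suc (copyStart a (suc ℓ)) ] endsIn-copy g t
      ≡⟨ cong (λ z → ∑< (suc z) (endsIn-copy g)) (sym L≡) ⟩
    ∑[ t < suc L ] endsIn-copy g t ∎
    where
    open ≤-Reasoning hiding (start)
    separator-ends : 1 ≤ endsIn-copy g L
    separator-ends = boundary⇒endsAt (s≤s z≤n)
      (subst (_≤ M) (sym (copyStart-after-sep L g)) (≤-trans (copyStart-mono L (s≤s g<ℓ)) (≤-reflexive (sym M≡))))
      (subst (BoundaryAfter φ) (sym (copyStart-after-sep L g)) (boundary-after-copy g<ℓ))

  ends-after-B≤phrasesIn : ∑[ g < ℓ ] ∑[ t < suc L ] endsIn-copy g t ≤ phrasesIn φ (L + 1) M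
  ends-after-B≤phrasesIn = begin
    ∑[ g < ℓ ] ∑[ t < suc L ] endsIn-copy g t
      ≡⟨ ∑-cong ℓ (λ {g} _ → ∑-cong (suc L) (λ {t} _ → cong (endsAt φ) (reindex L g t))) ⟩
    ∑[ g < ℓ ] ∑[ t < suc L ] endsAt φ (L + 1 + (g * suc L + t))
      ≡⟨ sym (∑-blocks ℓ (suc L) (λ t → endsAt φ (L + 1 + t))) ⟩
    ∑[ t < ℓ * suc L ] endsAt φ (L + 1 + t)
      ≤⟨ endsAt-window≤phrasesIn φ {L + 1} (copyStart L ℓ) starts-after-B ⟩
    phrasesIn φ (L + 1) (L + 1 + copyStart L ℓ)
      ≡⟨ cong (phrasesIn φ (L + 1)) (trans (+-assoc L 1 (copyStart L ℓ)) (sym M≡)) ⟩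
    phrasesIn φ (L + 1) M ∎
    where
    open ≤-Reasoning hiding (start)
    reindex : ∀ l g t → suc (l + g * suc l + t) ≡ l + 1 + (g * suc l + t)
    reindex = solve-∀
    starts-after-B : ∀ {ph} → ph ∈ φ → L + 1 ≤ end ph → L + 1 ≤ start ph
    starts-after-B {ph} ph∈φ L+1≤en with start ph ≤? L
    ... | no  st≰L = subst (_≤ start ph) (+-comm 1 L) (≰⇒> st≰L)
    ... | yes st≤L = ⊥-elim (boundary-after-copy z≤n ph∈φ
                      (subst (start ph ≤_) (sym (+-identityʳ L)) st≤L ,
                       subst (_< end ph) (sym (+-identityʳ L)) (subst (_≤ end ph) (+-comm L 1) L+1≤en)))

  phrase-count : (x : ℕ → ℕ) → (∀ {j} → j < ℓ → copyStart a (suc j) < x j) →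
    (∀ {j} → j < ℓ → ∃[ g ] (g < ℓ × EndBeforeSeparator (x j) j g)) →
    2 * ℓ ≤ phrasesIn φ (L + 1) M
  phrase-count x x-after ends = begin
    2 * ℓ
      ≡⟨ cong₂ _+_ (sym (∑-one ℓ)) (trans (+-identityʳ ℓ) (sym (∑-one ℓ))) ⟩
    ∑[ j < ℓ ] 1 + ∑[ g < ℓ ] 1
      ≤⟨ +-monoˡ-≤ _ (∑-mono-≤ ℓ some-copy-ends) ⟩
    ∑[ j < ℓ ] ∑[ g < ℓ ] endsIn-copy-of-A g j + ∑[ g < ℓ ] 1
      ≡⟨ cong (_+ ∑< ℓ (λ _ → 1)) (sym (∑-comm ℓ ℓ endsIn-copy-of-A)) ⟩
    ∑[ g < ℓ ] ∑[ j < ℓ ] endsIn-copy-of-A g j + ∑[ g < ℓ ] 1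
      ≡⟨ sym (∑-distrib-+ ℓ (λ g → ∑< ℓ (endsIn-copy-of-A g)) (λ _ → 1)) ⟩
    ∑[ g < ℓ ] (∑[ j < ℓ ] endsIn-copy-of-A g j + 1)
      ≤⟨ ∑-mono-≤ ℓ ends-per-copy ⟩
    ∑[ g < ℓ ] ∑[ t < suc L ] endsIn-copy g t
      ≤⟨ ends-after-B≤phrasesIn ⟩
    phrasesIn φ (L + 1) M ∎
    where
    open ≤-Reasoning hiding (start)
    some-copy-ends : ∀ {j} → j < ℓ → 1 ≤ ∑[ g < ℓ ] endsIn-copy-of-A g j
    some-copy-ends {j} j<ℓ =
      let g , g<ℓ , end-in = ends j<ℓ
          ph , ph∈φ , X≤en , en≤hash = find end-in
          u , u≤a , en≡ = offset-in-window (x-after j<ℓ) X≤en en≤hash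
      in  begin
        1                                        ≤⟨ endsAt-end ph∈φ ⟩
        endsAt φ (end ph)                        ≡⟨ cong (endsAt φ) en≡ ⟩
        endsIn-copy g (copyStart a (suc j) + u)  ≤⟨ ∑-term (suc a) (λ u → endsIn-copy g (copyStart a (suc j) + u)) (s≤s u≤a) ⟩
        endsIn-copy-of-A g j                     ≤⟨ ∑-term ℓ (λ g → endsIn-copy-of-A g j) g<ℓ ⟩
        ∑[ g < ℓ ] endsIn-copy-of-A g j          ∎

  deep-in-every-copy : (x : ℕ → ℕ) →
    (∀ {j} → j < ℓ → (copyStart a (suc j) < x j × x j ≤ sepA j) × ∃[ h ] (Hop φ (x j) h × i + 1 < h)) →
    phrasesIn φ (L + 1) M < 2 * ℓ →
    ∃[ j ] (j < ℓ × ∀ g → g < ℓ → ∃[ h ] (Hop φ (copyStart L (suc g) + x j) h × i + 2 < h))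
  deep-in-every-copy x x-spec few-phrases =
    [ deep-everywhere , ⊥-elim ∘′ too-many-phrases ]′ (bounded-dichotomy Window window? ℓ ℓ)
    where
    Window : ℕ → ℕ → Set
    Window j = EndBeforeSeparator (x j) j
    window? : ∀ j g → Dec (Window j g)
    window? j g = phraseEndIn? φ (copyStart L (suc g) + x j) (suc (copyStart L (suc g) + sepA j))
    too-many-phrases : (∀ {j} → j < ℓ → ∃[ g ] (g < ℓ × Window j g)) → ⊥
    too-many-phrases ends = <⇒≱ few-phrases (phrase-count x (proj₁ ∘′ proj₁ ∘′ x-spec) ends)
    deep-everywhere : ∃[ j ] (j < ℓ × ∀ {g} → g < ℓ → ¬ Window j g) →
      ∃[ j ] (j < ℓ × ∀ g → g < ℓ → ∃[ h ] (Hop φ (copyStart L (suc g) + x j) h × i + 2 < h))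
    deep-everywhere (j , j<ℓ , no-end) =
      let (x-after , x≤sepA) , h₀ , hop₀ , deep = x-spec j<ℓ
      in  j , j<ℓ , hop-in-copies j<ℓ (≤-<-trans z≤n x-after) x≤sepA hop₀ deep no-end

lemma5 : (G : Graph) (c ℓ : ℕ) → 3 ≤ c → 1 ≤ ℓ
    → (φ : List Phrase) → IsLZParsing (sG G c ℓ) φ
    → (i : ℕ) → 1 ≤ i → i ≤ c ∸ 2
    → (x : ℕ → ℕ)
    → (∀ j → 1 ≤ j → j ≤ ℓ →
         (copyOff G ℓ i j + 1 ≤ x j × x j ≤ copyOff G ℓ i j + length (alpha G ℓ i))
         × ∃[ h ] (Hop φ (x j) h × i + 1 < h))
    → phrasesIn φ (length (alpha G ℓ (suc i)) + 1) (length (alpha G ℓ (suc (suc i)))) < 2 * ℓ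
    → ∃[ j ] (1 ≤ j × j ≤ ℓ
         × (∀ γ → 1 ≤ γ → γ ≤ ℓ →
              ∃[ h ] (Hop φ (copyOff G ℓ (suc i) γ + x j) h × i + 2 < h)))
lemma5 G (suc (suc c′)) (suc ℓ₀) _ _ φ (tiles , lz) (suc i₀) _ i≤c∸2 x x-spec few-phrases =
  let j , j<ℓ , deep-copies = deep-in-every-copy (x ∘′ suc) x-spec′ few-phrases
  in  suc j , s≤s z≤n , j<ℓ , λ { (suc g) _ g<ℓ → deep-copies g g<ℓ }
  where
  open Construction G (suc ℓ₀)
  C-prefix : ∃[ ys ] sG G (suc (suc c′)) (suc ℓ₀) ≡ alpha G (suc ℓ₀) (suc (suc (suc i₀))) ++ ys
  C-prefix = alpha-prefix (s≤s (s≤s i≤c∸2))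
  open HopPropagation ℓ₀ (suc i₀) (alpha G (suc ℓ₀) (suc i₀)) _ _
         (alpha-below (suc i₀)) (alpha-suc i₀) (alpha-suc (suc i₀)) C-prefix tiles lz
  x-spec′ : ∀ {j} → j < ℓ →
    (copyStart a (suc j) < x (suc j) × x (suc j) ≤ sepA j) × ∃[ h ] (Hop φ (x (suc j)) h × suc i₀ + 1 < h)
  x-spec′ {j} j<ℓ =
    let (lo , hi) , deep = x-spec (suc j) (s≤s z≤n) j<ℓ
    in  (subst (_≤ x (suc j)) (+-comm _ 1) lo , hi) , deep
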